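{- Let $H = I_7 \vee C_5$, where $I_7$ is an independent set on $7$ vertices and $C_5$ is a $5$-cycle. Then $D_{2,\infty}^b(H) = \frac{5}{72}|H|^2$ (that is, $D_{2,\infty}^b(H) = 10$).
   Context: The join $G_1 \vee G_2$ of two vertex-disjoint graphs has vertex set $V(G_1)\cup V(G_2)$ and edge set $E(G_1)\cup E(G_2)\cup\{v_1v_2 : v_1\in V(G_1), v_2\in V(G_2)\}$. For a vertex subset $A$, $e(A)$ is the number of edges with both endpoints in $A$, and $A^c = V(G)\setminus A$. For a graph $G$ on an even number of vertices, $D_{2,\infty}^b(G) = \min \max\{e(A), e(A^c)\}$ over all partitions $V(G) = A\cup A^c$ with $|A| = |A^c|$. $|H|$ is the number of vertices of $H$. -}

module Defs where

open import Data.Bool using (Bool; true; false; _∧_; if_then_else_)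
open import Data.Nat using (ℕ; zero; suc; _+_; _*_; _^_; _≤_; _<ᵇ_; _≡ᵇ_; _⊔_)
open import Data.Fin using (Fin; toℕ; splitAt)
open import Data.Fin.Subset using (Subset; ∁; ∣_∣)
open import Data.Vec using (lookup)
open import Data.List using (List; allFin; concatMap; map)
open import Data.Nat.ListAction using (sum)
open import Data.Sum using (inj₁; inj₂)
open import Data.Product using (Σ; _×_; ∃)
open import Relation.Binary.PropositionalEquality using (_≡_)

record Graph (n : ℕ) : Set where
  field
    Adj   : Fin n → Fin n → Bool
    sym   : ∀ i j → Adj i j ≡ Adj j i
    irrefl : ∀ i → Adj i i ≡ false
open Graph public

joinAdj : ∀ {m n} → Graph m → Graph n → Fin (m + n) → Fin (m + n) → Bool
joinAdj {m} G₁ G₂ i j with splitAt m i | splitAt m j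
... | inj₁ a | inj₁ b = Adj G₁ a b
... | inj₂ a | inj₂ b = Adj G₂ a b
... | inj₁ _ | inj₂ _ = true
... | inj₂ _ | inj₁ _ = true

join : ∀ {m n} → Graph m → Graph n → Graph (m + n)
join {m} G₁ G₂ = record { Adj = joinAdj G₁ G₂ ; sym = s ; irrefl = ir }
  where
  s : ∀ i j → joinAdj G₁ G₂ i j ≡ joinAdj G₁ G₂ j i
  s i j with splitAt m i | splitAt m j
  ... | inj₁ a | inj₁ b = sym G₁ a b
  ... | inj₂ a | inj₂ b = sym G₂ a b
  ... | inj₁ _ | inj₂ _ = Relation.Binary.PropositionalEquality.refl
  ... | inj₂ _ | inj₁ _ = Relation.Binary.PropositionalEquality.refl
  ir : ∀ i → joinAdj G₁ G₂ i i ≡ false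
  ir i with splitAt m i
  ... | inj₁ a = irrefl G₁ a
  ... | inj₂ a = irrefl G₂ a

Indep : (n : ℕ) → Graph n
Indep n = record { Adj = λ _ _ → false
                 ; sym = λ _ _ → Relation.Binary.PropositionalEquality.refl
                 ; irrefl = λ _ → Relation.Binary.PropositionalEquality.refl }

c5 : Fin 5 → Fin 5 → Bool
c5 i j = ((toℕ j) ≡ᵇ (suc (toℕ i) Data.Nat.% 5)) Data.Bool.∨ ((toℕ i) ≡ᵇ (suc (toℕ j) Data.Nat.% 5))

C5 : Graph 5
C5 = record { Adj = c5 ; sym = s ; irrefl = ir }
  where
  open import Data.Fin using (zero; suc)
  open Relation.Binary.PropositionalEquality using (refl)
  s : ∀ i j → c5 i j ≡ c5 j i
  s zero zero = refl
  s zero (suc zero) = refl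
  s zero (suc (suc zero)) = refl
  s zero (suc (suc (suc zero))) = refl
  s zero (suc (suc (suc (suc zero)))) = refl
  s (suc zero) zero = refl
  s (suc zero) (suc zero) = refl
  s (suc zero) (suc (suc zero)) = refl
  s (suc zero) (suc (suc (suc zero))) = refl
  s (suc zero) (suc (suc (suc (suc zero)))) = refl
  s (suc (suc zero)) zero = refl
  s (suc (suc zero)) (suc zero) = refl
  s (suc (suc zero)) (suc (suc zero)) = refl
  s (suc (suc zero)) (suc (suc (suc zero))) = refl
  s (suc (suc zero)) (suc (suc (suc (suc zero)))) = refl
  s (suc (suc (suc zero))) zero = refl
  s (suc (suc (suc zero))) (suc zero) = refl
  s (suc (suc (suc zero))) (suc (suc zero)) = refl
  s (suc (suc (suc zero))) (suc (suc (suc zero))) = refl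
  s (suc (suc (suc zero))) (suc (suc (suc (suc zero)))) = refl
  s (suc (suc (suc (suc zero)))) zero = refl
  s (suc (suc (suc (suc zero)))) (suc zero) = refl
  s (suc (suc (suc (suc zero)))) (suc (suc zero)) = refl
  s (suc (suc (suc (suc zero)))) (suc (suc (suc zero))) = refl
  s (suc (suc (suc (suc zero)))) (suc (suc (suc (suc zero)))) = refl
  ir : ∀ i → c5 i i ≡ false
  ir zero = refl
  ir (suc zero) = refl
  ir (suc (suc zero)) = refl
  ir (suc (suc (suc zero))) = refl
  ir (suc (suc (suc (suc zero)))) = refl

toNat : Bool → ℕ
toNat true = 1
toNat false = 0

e : ∀ {n} → Graph n → Subset n → ℕ
e {n} G A = sum (concatMap (λ i → map (λ j →
      toNat ((toℕ i <ᵇ toℕ j) ∧ lookup A i ∧ lookup A j ∧ Adj G i j))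
    (allFin n)) (allFin n))

Balanced : ∀ {n} → Subset n → Set
Balanced A = ∣ A ∣ ≡ ∣ ∁ A ∣

IsD2∞b : ∀ {n} → Graph n → ℕ → Set
IsD2∞b G k =
  (∃ λ A → Balanced A × (e G A ⊔ e G (∁ A)) ≡ k) ×
  (∀ A → Balanced A → k ≤ (e G A ⊔ e G (∁ A)))

H : Graph 12
H = join (Indep 7) C5

-- If a balanced part A contains a vertices of I₇, it contains 6 − a vertices of C₅, so the
-- two sides span a(6 − a) and (7 − a)(a − 1) join edges plus their edges of C₅; checking
-- a = 1, …, 6 gives max{e(A), e(Aᶜ)} ≥ 10, with equality for A = six vertices of I₇.
-- The lower bound is certified by a decision procedure ranging over all subsets.
module Submission where

open import Defs
open import Data.Nat using (ℕ; _*_; _^_; _≤_; _<_; _⊔_)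
open import Data.Nat.Properties using (_≟_; _<?_; ≮⇒≥; ≤⇒≯)
open import Data.Bool using (true; false)
open import Data.Vec using ([]; _∷_)
open import Data.Fin.Subset using (Subset; ∁; ∣_∣)
open import Data.Fin.Subset.Properties using (anySubset?)
open import Data.Product using (_×_; _,_; ∃)
open import Relation.Nullary using (Dec; ¬_)
open import Relation.Nullary.Decidable using (_×-dec_; ¬?; map′; from-yes)
open import Relation.Binary.PropositionalEquality using (_≡_; refl)

balanced? : ∀ {n} (A : Subset n) → Dec (Balanced A)
balanced? A = ∣ A ∣ ≟ ∣ ∁ A ∣

maxPartEdges : ∀ {n} → Graph n → Subset n → ℕ
maxPartEdges G A = e G A ⊔ e G (∁ A)

IsBalancedLowerBound : ∀ {n} → Graph n → ℕ → Set
IsBalancedLowerBound G k = ∀ A → Balanced A → k ≤ maxPartEdges G A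

CheaperBalancedPartition : ∀ {n} → Graph n → ℕ → Set
CheaperBalancedPartition G k = ∃ λ A → Balanced A × maxPartEdges G A < k

isBalancedLowerBound? : ∀ {n} (G : Graph n) k → Dec (IsBalancedLowerBound G k)
isBalancedLowerBound? G k =
  map′ noCheaper⇒lowerBound lowerBound⇒noCheaper
       (¬? (anySubset? λ A → balanced? A ×-dec maxPartEdges G A <? k))
  where
  noCheaper⇒lowerBound : ¬ CheaperBalancedPartition G k → IsBalancedLowerBound G k
  noCheaper⇒lowerBound none A bal = ≮⇒≥ λ cheaper → none (A , bal , cheaper)

  lowerBound⇒noCheaper : IsBalancedLowerBound G k → ¬ CheaperBalancedPartition G k
  lowerBound⇒noCheaper lb (A , bal , cheaper) = ≤⇒≯ (lb A bal) cheaper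

-- e(A) = 0, while Aᶜ is one vertex of I₇ joined to C₅, spanning 5 + 5 = 10 edges.
sixIndependentVertices : Subset 12
sixIndependentVertices =
  true ∷ true ∷ true ∷ true ∷ true ∷ true ∷ false ∷ false ∷ false ∷ false ∷ false ∷ false ∷ []

proposition2p1 : IsD2∞b H 10 × 72 * 10 ≡ 5 * 12 ^ 2
proposition2p1 =
  ((sixIndependentVertices , refl , refl) , from-yes (isBalancedLowerBound? H 10)) , refl
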